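{- Let $G=G([n],E)$ be a finite simple graph and $k\in\mathbb{P}$. The map sending a monomial $\mathbf{x}^{\mathbf{b}}\notin B_{\mathcal{C}(G,k)}$ ($\mathbf{b}\in\mathbb{N}^{[n]}$) to the vertex set $\{i\in[n]:b_i=0\}$ restricts to a bijection between the square-free standard monomials of $B_{\mathcal{C}(G,k)}$ and the subsets $A\subseteq[n]$ that percolate in $G$ under $k$-neighbor bootstrap percolation.
   Context: $k$-neighbor bootstrap percolation with initial set $A\subseteq[n]$: $A_0=A$ and $A_t=A_{t-1}\cup\{i\in[n]:|N_G(i)\cap A_{t-1}|\ge k\}$ for $t\ge1$; the closure is $\mathrm{cl}(A)=\bigcup_t A_t$, and $A$ percolates if $\mathrm{cl}(A)=[n]$. For $\sigma\subseteq[n]$ and $i\in\sigma$, $\mathrm{deg}^{\mathrm{out}}_\sigma(i)=|\{j\in[n]\setminus\sigma:\{i,j\}\in E\}|$. $\mathcal{C}(G,k)=\{\sigma\subseteq[n]:\mathrm{deg}^{\mathrm{out}}_\sigma(i)<k\text{ for all }i\in\sigma\}$, and $B_{\mathcal{C}(G,k)}\subseteq\mathbf{k}[x_1,\dots,x_n]$ is the square-free monomial ideal generated by $\prod_{i\in\sigma}x_i$, $\sigma\in\mathcal{C}(G,k)$. A standard monomial is a monomial not in the ideal. -}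

module Defs where

open import Data.Nat using (ℕ; zero; suc; _≤_; _<_; _≤ᵇ_)
open import Data.Bool using (Bool; true; false; _∨_; _∧_; not)
open import Data.Fin using (Fin)
open import Data.Fin.Subset using (Subset; _∈_; _∉_; _⊆_; ∣_∣; _∩_; ∁; Nonempty)
open import Data.Vec using (Vec; tabulate; lookup)
open import Data.Product using (Σ; ∃; _×_)
open import Relation.Binary.PropositionalEquality using (_≡_)
open import Relation.Nullary using (¬_)

record SimpleGraph (n : ℕ) : Set where
  field
    adj   : Fin n → Fin n → Bool
    sym   : ∀ i j → adj i j ≡ adj j i
    irrfl : ∀ i → adj i i ≡ false

open SimpleGraph public

N : ∀ {n} → SimpleGraph n → Fin n → Subset n
N G i = tabulate (adj G i)

step : ∀ {n} → SimpleGraph n → ℕ → Subset n → Subset n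
step G k A = tabulate (λ i → lookup A i ∨ (k ≤ᵇ ∣ N G i ∩ A ∣))

iter : ∀ {n} → SimpleGraph n → ℕ → Subset n → ℕ → Subset n
iter G k A zero    = A
iter G k A (suc t) = step G k (iter G k A t)

-- cl(A) = ⋃_t A_t, so A percolates (cl(A) = [n]) iff every i lies in some A_t
-- A percolates: cl(A) = [n]
Percolates : ∀ {n} → SimpleGraph n → ℕ → Subset n → Set
Percolates G k A = ∀ i → ∃ λ t → i ∈ iter G k A t

degOut : ∀ {n} → SimpleGraph n → Subset n → Fin n → ℕ
degOut G σ i = ∣ N G i ∩ ∁ σ ∣

InC : ∀ {n} → SimpleGraph n → ℕ → Subset n → Set
InC G k σ = Nonempty σ × (∀ i → i ∈ σ → degOut G σ i < k)

-- monomials x^b are given by exponent vectors b ∈ ℕ^[n]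
Exponent : ℕ → Set
Exponent n = Vec ℕ n

-- exponent vector of the square-free monomial ∏_{i ∈ σ} x_i
indicator : ∀ {n} → Subset n → Exponent n
indicator σ = tabulate (λ i → if' (lookup σ i))
  where
  if' : Bool → ℕ
  if' true  = 1
  if' false = 0

_∣ᵐ_ : ∀ {n} → Exponent n → Exponent n → Set
a ∣ᵐ b = ∀ i → lookup a i ≤ lookup b i

-- x^b ∈ B_{𝒞(G,k)}: a monomial lies in a monomial ideal iff it is divisible
-- by one of the monomial generators
InB : ∀ {n} → SimpleGraph n → ℕ → Exponent n → Set
InB G k b = ∃ λ σ → InC G k σ × (indicator σ ∣ᵐ b)

Standard : ∀ {n} → SimpleGraph n → ℕ → Exponent n → Set
Standard G k b = ¬ InB G k b

SquareFree : ∀ {n} → Exponent n → Set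
SquareFree b = ∀ i → lookup b i ≤ 1

zeroSet : ∀ {n} → Exponent n → Subset n
zeroSet b = tabulate (λ i → isZero (lookup b i))
  where
  isZero : ℕ → Bool
  isZero zero    = true
  isZero (suc _) = false

{-# OPTIONS --safe #-}
-- Call C ⊆ [n] closed if no vertex outside C has k neighbours in C. Since
-- deg^out_σ(i) = |N(i) ∩ ∁σ|, 𝒞(G,k) consists exactly of the complements of proper closed
-- sets, and a closed set containing A contains every A_t. The chain A_t stalls after at most
-- n + 1 rounds, at a closed set, which is therefore cl(A). A monomial x^b is divisible by
-- x^σ iff σ avoids the zeros of b, so x^b is standard iff no proper closed set contains
-- zeroSet b, i.e. iff zeroSet b percolates. A square-free b is the indicator of the
-- complement of its zero set.
module Submission where

open import Defs hiding (sym)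
open import Data.Nat using (ℕ; zero; suc; _≤_; _<_; z≤n; s≤s)
open import Data.Nat.Properties using (≤ᵇ⇒≤; ≤⇒≤ᵇ; ≤-trans; ≤-<-trans; ≰⇒>; <⇒≱; n≮n; n≢0⇒n>0; 1+n≰n)
open import Data.Bool using (true; false; not; T)
open import Data.Bool.Properties using (T-≡; T-∨; not-involutive)
open import Data.Fin using (Fin)
open import Data.Fin.Subset using (Subset; _∈_; _∉_; _⊆_; _⊂_; ∣_∣; _∩_; ∁)
open import Data.Fin.Subset.Properties
  using (_∈?_; x∈p∩q⁺; x∈p∩q⁻; p⊆q⇒∣p∣≤∣q∣; p⊂q⇒∣p∣<∣q∣; ∣p∣≤n; drop-∷-⊆; s⊂s; out⊂in;
         x∉p⇒x∈∁p; x∈∁p⇒x∉p; x∉∁p⇒x∈p)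
open import Data.Vec using ([]; _∷_; here; there; lookup; map)
open import Data.Vec.Properties using ([]=⇒lookup; lookup⇒[]=; lookup∘tabulate; map-∘; map-cong; map-id)
open import Data.Product using (∃; _×_; _,_)
open import Data.Sum using (_⊎_; inj₁; inj₂)
import Data.Sum as Sum
open import Function using (_∘_)
open import Function.Bundles using (Equivalence)
open import Relation.Nullary using (yes; no; contradiction)
open import Relation.Binary.PropositionalEquality using (_≡_; refl; sym; trans; cong; subst; subst₂; module ≡-Reasoning)

private
  variable
    n : ℕ
    i : Fin n
    p q r : Subset n

∈⇒T-lookup : i ∈ p → T (lookup p i)
∈⇒T-lookup = Equivalence.from T-≡ ∘ []=⇒lookup

T-lookup⇒∈ : ∀ {i : Fin n} {p} → T (lookup p i) → i ∈ p
T-lookup⇒∈ {i = i} {p} = lookup⇒[]= i p ∘ Equivalence.to T-≡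

∁-involutive : (p : Subset n) → ∁ (∁ p) ≡ p
∁-involutive p = begin
  map not (map not p)  ≡⟨ map-∘ not not p ⟨
  map (not ∘ not) p    ≡⟨ map-cong not-involutive p ⟩
  map (λ x → x) p      ≡⟨ map-id p ⟩
  p                    ∎
  where open ≡-Reasoning

∣p∩q∣≤∣p∩r∣ : q ⊆ r → ∣ p ∩ q ∣ ≤ ∣ p ∩ r ∣
∣p∩q∣≤∣p∩r∣ {q = q} {p = p} q⊆r = p⊆q⇒∣p∣≤∣q∣ λ x∈p∩q →
  let x∈p , x∈q = x∈p∩q⁻ p q x∈p∩q in x∈p∩q⁺ (x∈p , q⊆r x∈q)

p⊆q⇒p⊂q⊎p≡q : p ⊆ q → p ⊂ q ⊎ p ≡ q
p⊆q⇒p⊂q⊎p≡q {p = []}        {[]}        _   = inj₂ refl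
p⊆q⇒p⊂q⊎p≡q {p = true ∷ p}  {false ∷ q} p⊆q = contradiction (p⊆q here) λ ()
p⊆q⇒p⊂q⊎p≡q {p = false ∷ p} {true ∷ q}  p⊆q = inj₁ (out⊂in (drop-∷-⊆ p⊆q))
p⊆q⇒p⊂q⊎p≡q {p = true ∷ p}  {true ∷ q}  p⊆q =
  Sum.map s⊂s (cong (true ∷_)) (p⊆q⇒p⊂q⊎p≡q (drop-∷-⊆ p⊆q))
p⊆q⇒p⊂q⊎p≡q {p = false ∷ p} {false ∷ q} p⊆q =
  Sum.map s⊂s (cong (false ∷_)) (p⊆q⇒p⊂q⊎p≡q (drop-∷-⊆ p⊆q))

chain-stalls : (X : ℕ → Subset n) → (∀ t → X t ⊆ X (suc t)) → ∃ λ t → X (suc t) ≡ X t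
chain-stalls {n} X increasing with grows-or-stalls (suc n)
  where
  grows-or-stalls : ∀ t → t ≤ ∣ X t ∣ ⊎ ∃ λ s → X (suc s) ≡ X s
  grows-or-stalls zero = inj₁ z≤n
  grows-or-stalls (suc t) with grows-or-stalls t
  ... | inj₂ stall = inj₂ stall
  ... | inj₁ t≤∣Xt∣ with p⊆q⇒p⊂q⊎p≡q (increasing t)
  ...   | inj₁ Xt⊂Xt+1 = inj₁ (≤-<-trans t≤∣Xt∣ (p⊂q⇒∣p∣<∣q∣ Xt⊂Xt+1))
  ...   | inj₂ Xt≡Xt+1 = inj₂ (t , sym Xt≡Xt+1)
... | inj₁ n+1≤∣X∣ = contradiction (≤-trans n+1≤∣X∣ (∣p∣≤n (X (suc n)))) (n≮n n)
... | inj₂ stall   = stall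

module Percolation (G : SimpleGraph n) (k : ℕ) where

  ∈-step⁺ : i ∈ p ⊎ k ≤ ∣ N G i ∩ p ∣ → i ∈ step G k p
  ∈-step⁺ {i = i} =
    T-lookup⇒∈ ∘ subst T (sym (lookup∘tabulate _ i)) ∘ Equivalence.from T-∨ ∘ Sum.map ∈⇒T-lookup ≤⇒≤ᵇ

  ∈-step⁻ : i ∈ step G k p → i ∈ p ⊎ k ≤ ∣ N G i ∩ p ∣
  ∈-step⁻ {i = i} =
    Sum.map T-lookup⇒∈ (≤ᵇ⇒≤ k _) ∘ Equivalence.to T-∨ ∘ subst T (lookup∘tabulate _ i) ∘ ∈⇒T-lookup

  p⊆step : p ⊆ step G k p
  p⊆step = ∈-step⁺ ∘ inj₁

  p⊆iter : ∀ t → p ⊆ iter G k p t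
  p⊆iter zero    = λ i∈p → i∈p
  p⊆iter (suc t) = p⊆step ∘ p⊆iter t

  Closed : Subset n → Set
  Closed c = ∀ {i} → i ∉ c → ∣ N G i ∩ c ∣ < k

  step-fixed⇒closed : step G k p ≡ p → Closed p
  step-fixed⇒closed fixed i∉p = ≰⇒> λ k≤ → i∉p (subst (_ ∈_) fixed (∈-step⁺ (inj₂ k≤)))

  closed⇒step⊆ : Closed r → p ⊆ r → step G k p ⊆ r
  closed⇒step⊆ {r = r} closed p⊆r {i} i∈step with ∈-step⁻ i∈step | i ∈? r
  ... | inj₁ i∈p | _       = p⊆r i∈p
  ... | inj₂ k≤  | yes i∈r = i∈r
  ... | inj₂ k≤  | no i∉r  = contradiction (≤-trans k≤ (∣p∩q∣≤∣p∩r∣ {p = N G i} p⊆r)) (<⇒≱ (closed i∉r))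

  closed⇒iter⊆ : Closed r → p ⊆ r → ∀ t → iter G k p t ⊆ r
  closed⇒iter⊆ closed p⊆r zero    = p⊆r
  closed⇒iter⊆ closed p⊆r (suc t) = closed⇒step⊆ closed (closed⇒iter⊆ closed p⊆r t)

  degOut<k⇒∁-closed : (∀ i → i ∈ p → degOut G p i < k) → Closed (∁ p)
  degOut<k⇒∁-closed degOut<k i∉∁p = degOut<k _ (x∉∁p⇒x∈p i∉∁p)

  closed⇒∁-InC : Closed r → i ∉ r → InC G k (∁ r)
  closed⇒∁-InC {r = r} {i = i} closed i∉r = (i , x∉p⇒x∈∁p i∉r) , degOut<k
    where
    degOut<k : ∀ j → j ∈ ∁ r → degOut G (∁ r) j < k
    degOut<k j j∈∁r rewrite ∁-involutive r = closed (x∈∁p⇒x∉p j∈∁r)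

  iter-stalls : ∀ p → ∃ λ t → step G k (iter G k p t) ≡ iter G k p t
  iter-stalls p = chain-stalls (iter G k p) (λ _ → p⊆step)

∈-zeroSet⁺ : (b : Exponent n) → lookup b i ≡ 0 → i ∈ zeroSet b
∈-zeroSet⁺ {i = Fin.zero}  (zero ∷ b) _    = here
∈-zeroSet⁺ {i = Fin.suc i} (_ ∷ b)    bᵢ≡0 = there (∈-zeroSet⁺ b bᵢ≡0)

∈-zeroSet⁻ : (b : Exponent n) → i ∈ zeroSet b → lookup b i ≡ 0
∈-zeroSet⁻ (zero ∷ b) here       = refl
∈-zeroSet⁻ (_ ∷ b)    (there i∈) = ∈-zeroSet⁻ b i∈

lookup-indicator-∈ : i ∈ p → lookup (indicator p) i ≡ 1
lookup-indicator-∈ here        = refl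
lookup-indicator-∈ (there i∈p) = lookup-indicator-∈ i∈p

lookup-indicator-∉ : i ∉ p → lookup (indicator p) i ≡ 0
lookup-indicator-∉ {i = Fin.zero}  {p = false ∷ p} _   = refl
lookup-indicator-∉ {i = Fin.zero}  {p = true ∷ p}  i∉p = contradiction here i∉p
lookup-indicator-∉ {i = Fin.suc i} {p = _ ∷ p}     i∉p = lookup-indicator-∉ (i∉p ∘ there)

indicator-squareFree : (p : Subset n) → SquareFree (indicator p)
indicator-squareFree p i with i ∈? p
... | yes i∈p rewrite lookup-indicator-∈ i∈p = s≤s z≤n
... | no i∉p  rewrite lookup-indicator-∉ i∉p = z≤n

zeroSet-indicator : (p : Subset n) → zeroSet (indicator p) ≡ ∁ p
zeroSet-indicator []          = refl
zeroSet-indicator (true ∷ p)  = cong (false ∷_) (zeroSet-indicator p)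
zeroSet-indicator (false ∷ p) = cong (true ∷_) (zeroSet-indicator p)

indicator-∁-zeroSet : (b : Exponent n) → SquareFree b → indicator (∁ (zeroSet b)) ≡ b
indicator-∁-zeroSet []                 _  = refl
indicator-∁-zeroSet (zero ∷ b)         sf = cong (0 ∷_) (indicator-∁-zeroSet b (sf ∘ Fin.suc))
indicator-∁-zeroSet (suc zero ∷ b)     sf = cong (1 ∷_) (indicator-∁-zeroSet b (sf ∘ Fin.suc))
indicator-∁-zeroSet (suc (suc _) ∷ b)  sf with sf Fin.zero
... | s≤s ()

zeroSet-indicator-∁ : (p : Subset n) → zeroSet (indicator (∁ p)) ≡ p
zeroSet-indicator-∁ p = trans (zeroSet-indicator (∁ p)) (∁-involutive p)

zeroSet-injective : (b c : Exponent n) → SquareFree b → SquareFree c → zeroSet b ≡ zeroSet c → b ≡ c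
zeroSet-injective b c sfb sfc zb≡zc = begin
  b                            ≡⟨ indicator-∁-zeroSet b sfb ⟨
  indicator (∁ (zeroSet b))    ≡⟨ cong (indicator ∘ ∁) zb≡zc ⟩
  indicator (∁ (zeroSet c))    ≡⟨ indicator-∁-zeroSet c sfc ⟩
  c                            ∎
  where open ≡-Reasoning

indicator-∣ᵐ⁺ : (b : Exponent n) → zeroSet b ⊆ ∁ p → indicator p ∣ᵐ b
indicator-∣ᵐ⁺ {p = p} b zeros⊆∁p i with i ∈? p
... | no i∉p  rewrite lookup-indicator-∉ i∉p = z≤n
... | yes i∈p rewrite lookup-indicator-∈ i∈p =
  n≢0⇒n>0 λ bᵢ≡0 → x∈∁p⇒x∉p (zeros⊆∁p (∈-zeroSet⁺ b bᵢ≡0)) i∈p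

indicator-∣ᵐ⁻ : (b : Exponent n) → indicator p ∣ᵐ b → zeroSet b ⊆ ∁ p
indicator-∣ᵐ⁻ b p∣b {i} i∈zeros = x∉p⇒x∈∁p λ i∈p →
  1+n≰n (subst₂ _≤_ (lookup-indicator-∈ i∈p) (∈-zeroSet⁻ b i∈zeros) (p∣b i))

module _ (G : SimpleGraph n) (k : ℕ) where
  open Percolation G k

  closed-proper⇒InB : (b : Exponent n) → Closed r → zeroSet b ⊆ r → i ∉ r → InB G k b
  closed-proper⇒InB {r = r} b closed zeros⊆r i∉r =
    ∁ r , closed⇒∁-InC closed i∉r , indicator-∣ᵐ⁺ b (subst (zeroSet b ⊆_) (sym (∁-involutive r)) zeros⊆r)

  standard⇒percolates : (b : Exponent n) → Standard G k b → Percolates G k (zeroSet b)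
  standard⇒percolates b standard i with iter-stalls (zeroSet b)
  ... | t , stalled with i ∈? iter G k (zeroSet b) t
  ...   | yes i∈Aₜ = t , i∈Aₜ
  ...   | no i∉Aₜ  = contradiction (closed-proper⇒InB b (step-fixed⇒closed stalled) (p⊆iter t) i∉Aₜ) standard

  percolates⇒standard : (A : Subset n) → Percolates G k A → Standard G k (indicator (∁ A))
  percolates⇒standard A percolates (σ , ((i , i∈σ) , degOut<k) , σ∣b) with percolates i
  ... | t , i∈Aₜ = x∈∁p⇒x∉p (closed⇒iter⊆ (degOut<k⇒∁-closed degOut<k) A⊆∁σ t i∈Aₜ) i∈σ
    where
    A⊆∁σ : A ⊆ ∁ σ
    A⊆∁σ = subst (_⊆ ∁ σ) (zeroSet-indicator-∁ A) (indicator-∣ᵐ⁻ (indicator (∁ A)) σ∣b)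

proposition5p21 : (n : ℕ) (G : SimpleGraph n) (k : ℕ) → 1 ≤ k →
    -- the map lands in the percolating sets
    ((b : Exponent n) → SquareFree b → Standard G k b → Percolates G k (zeroSet b))
    -- injective on square-free standard monomials
    × ((b c : Exponent n) → SquareFree b → Standard G k b → SquareFree c → Standard G k c →
         zeroSet b ≡ zeroSet c → b ≡ c)
    -- surjective onto the percolating sets
    × ((A : Subset n) → Percolates G k A →
         ∃ λ b → SquareFree b × Standard G k b × zeroSet b ≡ A)
proposition5p21 n G k _ =
    (λ b _ → standard⇒percolates G k b)
  , (λ b c sfb _ sfc _ → zeroSet-injective b c sfb sfc)
  , λ A percolates → indicator (∁ A)
                   , indicator-squareFree (∁ A) , percolates⇒standard G k A percolates , zeroSet-indicator-∁ A
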